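{- Let $\Delta$ be an alphabet and $a\in\Delta$. There exists an (in general nondeterministic) MSO graph transducer $N_\Delta^a$ whose inputs are strings over $\Delta$ (encoded as graphs) and whose outputs are discrete graphs, such that for every $w\in\Delta^*$, \[ N_\Delta^a(w)=\{{\rm dgr}(a^n)\mid n\ge 1,\ w/n=a\}. \] Moreover, $N_\Delta^a$ can be effectively constructed.
   Context: A graph over a graph alphabet $(\Sigma,\Gamma)$ (node labels $\Sigma$, edge labels $\Gamma$) is a tuple $(V,E,\lambda)$ with $V$ a finite set of nodes, $E\subseteq V\times\Gamma\times V$ and $\lambda:V\to\Sigma$. MSO formulas over $(\Sigma,\Gamma)$ use node variables and node-set variables (quantifiable), and atomic formulas ${\rm lab}_\sigma(x)$, ${\rm edg}_\gamma(x,y)$, $x\in X$. An MSO graph transducer from $(\Sigma_1,\Gamma_1)$ to $(\Sigma_2,\Gamma_2)$ is a tuple $(C,\varphi_{\rm dom},\Psi,X)$ with $C$ a finite set of copy names, all formulas MSO over $(\Sigma_1,\Gamma_1)$ that may additionally have fixed free node-set variables $Y_1,\dots,Y_k$ (parameters): a domain formula $\varphi_{\rm dom}$ (free variables only the parameters), node formulas $\psi_{c,\sigma}(x)$ for $c\in C,\sigma\in\Sigma_2$, and edge formulas $\chi_{c,c',\gamma}(x,y)$ for $c,c'\in C,\gamma\in\Gamma_2$. For an input graph $g$ and each valuation of the parameters by node sets of $g$ satisfying $\varphi_{\rm dom}$, an output graph $h$ is defined: $V_h$ is the set of pairs $(c,u)$, $c\in C$, $u\in V_g$, such that exactly one $\sigma\in\Sigma_2$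 has $(g,u)\models\psi_{c,\sigma}$; $(c,u)$ gets that label $\sigma$; and there is a $\gamma$-edge from $(c,u)$ to $(c',u')$ iff $(g,u,u')\models\chi_{c,c',\gamma}$ (all under the chosen valuation). $M(g)$ denotes the set of all output graphs for $g$. The transducer is deterministic if it has no parameters (then $M$ is a partial function). A string $w=a_1\cdots a_n$ over $\Delta$ is identified with the graph over $(\{\#\},\Delta)$ with $\#$-labeled nodes $v_1,\dots,v_{n+1}$ and, for $1\le i\le n$, an $a_i$-labeled edge from $v_i$ to $v_{i+1}$; $w/i$ denotes the $i$-th letter $a_i$ of $w$. A discrete graph (dgraph) is a graph without edges; for a string $w$ over $\Sigma$, ${\rm dgr}(w)$ is the (up to isomorphism unique) dgraph over $(\Sigma,\varnothing)$ having, for each $\sigma\in\Sigma$, as many $\sigma$-labeled nodes as there are occurrences of $\sigma$ in $w$. Output graphs are compared up to isomorphism. -}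

module Defs where

open import Data.Nat using (ℕ; zero; suc)
open import Data.Fin using (Fin; zero; suc; _≟_)
open import Data.Bool using (Bool; true; false; _∧_; _∨_; not; T)
open import Data.Bool.ListAction using (any; all)
open import Data.List using (List; []; _∷_; length; lookup; allFin; concatMap)
open import Data.Product using (Σ; _×_; _,_; proj₁; proj₂)
open import Relation.Binary.PropositionalEquality using (_≡_)
open import Relation.Nullary.Decidable using (⌊_⌋)
open import Function.Bundles using (_↔_; Inverse)

-- Graphs over a graph alphabet (Σ,Γ) with Σ = Fin s, Γ = Fin g.
-- Nodes are Fin n; the edge set E ⊆ V × Γ × V is given by its
-- (Boolean) characteristic function.

record Graph (s g : ℕ) : Set where
  field
    n    : ℕ
    lab  : Fin n → Fin s
    edge : Fin n → Fin g → Fin n → Bool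
open Graph public

record _≅_ {s g : ℕ} (G H : Graph s g) : Set where
  field
    iso      : Fin (n G) ↔ Fin (n H)
    lab-ok   : ∀ i → lab H (Inverse.to iso i) ≡ lab G i
    edge-ok  : ∀ i γ j → edge H (Inverse.to iso i) γ (Inverse.to iso j) ≡ edge G i γ j

-- MSO formulas over (Fin s, Fin g) with k node variables (Fin k) and
-- m node-set variables (Fin m) in scope (de Bruijn style).

data Form (s g : ℕ) : ℕ → ℕ → Set where
  labF  : ∀ {k m} → Fin s → Fin k → Form s g k m
  edgF  : ∀ {k m} → Fin g → Fin k → Fin k → Form s g k m
  memF  : ∀ {k m} → Fin k → Fin m → Form s g k m
  notF  : ∀ {k m} → Form s g k m → Form s g k m
  andF  : ∀ {k m} → Form s g k m → Form s g k m → Form s g k m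
  orF   : ∀ {k m} → Form s g k m → Form s g k m → Form s g k m
  exN   : ∀ {k m} → Form s g (suc k) m → Form s g k m
  allN  : ∀ {k m} → Form s g (suc k) m → Form s g k m
  exS   : ∀ {k m} → Form s g k (suc m) → Form s g k m
  allS  : ∀ {k m} → Form s g k (suc m) → Form s g k m

Subset : ℕ → Set
Subset n = Fin n → Bool

ext : ∀ {A : Set} {k : ℕ} → A → (Fin k → A) → Fin (suc k) → A
ext a ρ zero    = a
ext a ρ (suc i) = ρ i

allSubsets : (n : ℕ) → List (Subset n)
allSubsets zero    = (λ ()) ∷ []
allSubsets (suc n) = concatMap (λ f → ext false f ∷ ext true f ∷ []) (allSubsets n)

eval : ∀ {s g k m} (G : Graph s g) → Form s g k m →
       (Fin k → Fin (n G)) → (Fin m → Subset (n G)) → Bool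
eval G (labF σ x)   ρ η = ⌊ lab G (ρ x) ≟ σ ⌋
eval G (edgF γ x y) ρ η = edge G (ρ x) γ (ρ y)
eval G (memF x X)   ρ η = η X (ρ x)
eval G (notF φ)     ρ η = not (eval G φ ρ η)
eval G (andF φ ψ)   ρ η = eval G φ ρ η ∧ eval G ψ ρ η
eval G (orF φ ψ)    ρ η = eval G φ ρ η ∨ eval G ψ ρ η
eval G (exN φ)      ρ η = any (λ u → eval G φ (ext u ρ) η) (allFin (n G))
eval G (allN φ)     ρ η = all (λ u → eval G φ (ext u ρ) η) (allFin (n G))
eval G (exS φ)      ρ η = any (λ U → eval G φ ρ (ext U η)) (allSubsets (n G))
eval G (allS φ)     ρ η = all (λ U → eval G φ ρ (ext U η)) (allSubsets (n G))

-- MSO graph transducers from (Fin s₁, Fin g₁) to (Fin s₂, Fin g₂).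
-- C = Fin nC copy names; p parameters Y₁..Y_p (the free set variables).

record MSOT (s₁ g₁ s₂ g₂ : ℕ) : Set where
  field
    nC      : ℕ
    p       : ℕ
    dom     : Form s₁ g₁ 0 p
    nodeF   : Fin nC → Fin s₂ → Form s₁ g₁ 1 p
    edgeF   : Fin nC → Fin nC → Fin g₂ → Form s₁ g₁ 2 p
open MSOT public

module _ {s₁ g₁ s₂ g₂ : ℕ} (M : MSOT s₁ g₁ s₂ g₂) (G : Graph s₁ g₁)
         (Y : Fin (p M) → Subset (n G)) where

  one : Fin (n G) → Fin 1 → Fin (n G)
  one u _ = u

  two : Fin (n G) → Fin (n G) → Fin 2 → Fin (n G)
  two u u' zero    = u
  two u u' (suc _) = u'

  labOf : Fin (nC M) → Fin (n G) → Fin s₂ → Bool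
  labOf c u σ = eval G (nodeF M c σ) (one u) Y
              ∧ all (λ σ' → ⌊ σ' ≟ σ ⌋ ∨ not (eval G (nodeF M c σ') (one u) Y)) (allFin s₂)

  OutNode : Set
  OutNode = Σ (Fin (nC M) × Fin (n G) × Fin s₂) λ { (c , u , σ) → T (labOf c u σ) }

  outCopy : OutNode → Fin (nC M)
  outCopy ((c , u , σ) , _) = c

  outNode : OutNode → Fin (n G)
  outNode ((c , u , σ) , _) = u

  outLab : OutNode → Fin s₂
  outLab ((c , u , σ) , _) = σ

  record IsOutput (H : Graph s₂ g₂) : Set where
    field
      iso     : Fin (n H) ↔ OutNode
      lab-ok  : ∀ i → lab H i ≡ outLab (Inverse.to iso i)
      edge-ok : ∀ i γ j → edge H i γ j ≡
                  eval G (edgeF M (outCopy (Inverse.to iso i)) (outCopy (Inverse.to iso j)) γ)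
                         (two (outNode (Inverse.to iso i)) (outNode (Inverse.to iso j))) Y

-- H ∈ M(G) (up to isomorphism)
_∈⟦_⟧_ : ∀ {s₁ g₁ s₂ g₂} → Graph s₂ g₂ → MSOT s₁ g₁ s₂ g₂ → Graph s₁ g₁ → Set
H ∈⟦ M ⟧ G = Σ (Fin (p M) → Subset (n G)) λ Y →
               T (eval G (dom M) (λ ()) Y) × IsOutput M G Y H

-- Strings over Δ = Fin d as graphs over ({#}, Δ) = (Fin 1, Fin d)

strEdge : ∀ {d} (w : List (Fin d)) → Fin (suc (length w)) → Fin d → Fin (suc (length w)) → Bool
strEdge []      _       _ _             = false
strEdge (x ∷ w) zero    γ (suc zero)    = ⌊ x ≟ γ ⌋
strEdge (x ∷ w) zero    γ zero          = false
strEdge (x ∷ w) zero    γ (suc (suc _)) = false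
strEdge (x ∷ w) (suc i) γ zero          = false
strEdge (x ∷ w) (suc i) γ (suc j)       = strEdge w i γ j

strGraph : ∀ {d} → List (Fin d) → Graph 1 d
strGraph w = record { n = suc (length w) ; lab = λ _ → zero ; edge = strEdge w }

dgr : ∀ {s} → List (Fin s) → Graph s 0
dgr w = record { n = length w ; lab = lookup w ; edge = noEdge }
  where
  noEdge : Fin (length w) → Fin 0 → Fin (length w) → Bool
  noEdge _ () _

{-# OPTIONS --safe #-}
module Submission where

-- The transducer has one copy and one parameter Y.  Its domain formula says that some
-- a-edge leaves Y and that Y is closed under predecessors; on a string graph this holds
-- exactly when Y = {v₁,…,vₙ} with w/n = a.  It keeps precisely the nodes of Y, labels
-- them a and draws no edges, so its outputs are the dgraphs dgr(aⁿ) with w/n = a.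

open import Defs
open import Data.Nat using (ℕ; suc; zero; _+_; _∸_; _≤_; _<_; _≤ᵇ_; _≤?_; s≤s)
open import Data.Nat.Properties
  using (m∸n+n≡m; ≰⇒>; n≮n; m<n⇒m<1+n; ≤-pred; ≤-reflexive; ≤-trans; <⇒≤; suc-injective; ≤ᵇ⇒≤; ≤⇒≤ᵇ)
open import Data.Fin using (Fin; toℕ; zero; suc; inject₁; inject≤; fromℕ<; cast; _≟_)
open import Data.Fin.Properties
  using (toℕ-injective; toℕ-fromℕ<; toℕ-inject₁; toℕ-inject≤; toℕ<n; cast-involutive)
open import Data.List using (List; []; _∷_; length; lookup; replicate; allFin)
open import Data.List.Properties using (length-replicate; lookup-replicate)
import Data.List.Relation.Unary.All.Properties as All
import Data.List.Relation.Unary.Any.Properties as Any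
open import Data.Bool using (Bool; true; false; T; _∧_; _∨_; not; if_then_else_)
open import Data.Bool.Properties using (T-∧; T-irrelevant)
open import Data.Bool.ListAction using (any; all)
open import Data.Unit using (tt)
open import Data.Product using (Σ; ∃; ∃₂; _×_; _,_; proj₁; proj₂)
open import Data.Product.Function.NonDependent.Propositional using (_×-⇔_)
open import Function using (_∘_)
open import Function.Bundles using (_⇔_; _↔_; Inverse; module Equivalence; mk⇔; mk↔ₛ′)
open import Function.Properties.Equivalence using () renaming (trans to ⇔-trans)
open import Function.Properties.Inverse using (↔-sym; ↔-trans)
open import Relation.Binary.PropositionalEquality using (_≡_; refl; sym; trans; cong; subst)
open import Relation.Nullary using (¬_; yes; no; contradiction)
open import Relation.Nullary.Decidable using (⌊_⌋; toWitness; fromWitness)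

open Equivalence using (to; from)

T-not : ∀ {b} → T (not b) ⇔ (¬ T b)
T-not {false} = mk⇔ (λ _ ()) (λ _ → tt)
T-not {true}  = mk⇔ (λ ()) (λ ¬t → ¬t tt)

T-not-∨ : ∀ {b c} → T (not b ∨ c) ⇔ (T b → T c)
T-not-∨ {false} = mk⇔ (λ _ ()) (λ _ → tt)
T-not-∨ {true}  = mk⇔ (λ c _ → c) (λ f → f tt)

T-∨-not-∧ : ∀ b c → T (b ∨ not (b ∧ c))
T-∨-not-∧ false _ = tt
T-∨-not-∧ true  _ = tt

T-any-allFin : ∀ {n} (p : Fin n → Bool) → T (any p (allFin n)) ⇔ ∃ λ i → T (p i)
T-any-allFin p = mk⇔ (Any.tabulate⁻ ∘ Any.any⁻ p _) (λ (i , pi) → Any.any⁺ p (Any.tabulate⁺ i pi))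

T-all-allFin : ∀ {n} (p : Fin n → Bool) → T (all p (allFin n)) ⇔ (∀ i → T (p i))
T-all-allFin p = mk⇔ (All.tabulate⁻ ∘ All.all⁺ p _) (All.all⁻ p ∘ All.tabulate⁺)

DownClosed : ∀ {n} → (Fin (suc n) → Set) → Set
DownClosed P = ∀ j → P (suc j) → P (inject₁ j)

module _ {n} (P : Fin (suc n) → Set) (closed : DownClosed P) where

  downClosed-dist : ∀ m {u v : Fin (suc n)} → toℕ v ≡ m + toℕ u → P v → P u
  downClosed-dist zero    eq pv = subst P (toℕ-injective eq) pv
  downClosed-dist (suc m) {v = suc j} eq pv =
    downClosed-dist m (trans (toℕ-inject₁ j) (suc-injective eq)) (closed j pv)

  downClosed-≤ : ∀ {u v} → toℕ u ≤ toℕ v → P v → P u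
  downClosed-≤ {u} {v} u≤v = downClosed-dist (toℕ v ∸ toℕ u) (sym (m∸n+n≡m u≤v))

  downClosed-prefix : ∀ {k : Fin n} → P (inject₁ k) → ¬ P (suc k) → ∀ u → P u ⇔ toℕ u ≤ toℕ k
  downClosed-prefix {k} pk ¬pk+1 u =
    mk⇔ bounded (λ u≤k → downClosed-≤ (≤-trans u≤k (≤-reflexive (sym (toℕ-inject₁ k)))) pk)
    where
    bounded : P u → toℕ u ≤ toℕ k
    bounded pu with toℕ u ≤? toℕ k
    ... | yes u≤k = u≤k
    ... | no  u≰k = contradiction (downClosed-≤ (≰⇒> u≰k) pu) ¬pk+1

Σ-≤↔Fin : ∀ {n m} (S : Fin n → Bool) → m < n → (∀ u → T (S u) ⇔ toℕ u ≤ m) → Σ (Fin n) (T ∘ S) ↔ Fin (suc m)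
Σ-≤↔Fin {n} {m} S m<n spec = mk↔ₛ′ index element index∘element element∘index
  where
  index : Σ (Fin n) (T ∘ S) → Fin (suc m)
  index (u , su) = fromℕ< (s≤s (to (spec u) su))

  element : Fin (suc m) → Σ (Fin n) (T ∘ S)
  element j = inject≤ j m<n , from (spec _) (≤-trans (≤-reflexive (toℕ-inject≤ j m<n)) (≤-pred (toℕ<n j)))

  index∘element : ∀ j → index (element j) ≡ j
  index∘element j = toℕ-injective (trans (toℕ-fromℕ< _) (toℕ-inject≤ j m<n))

  element∘index : ∀ x → element (index x) ≡ x
  element∘index (u , su) = Σ-T-≡ (toℕ-injective (trans (toℕ-inject≤ _ m<n) (toℕ-fromℕ< _)))
    where
    Σ-T-≡ : ∀ {x y : Σ (Fin n) (T ∘ S)} → proj₁ x ≡ proj₁ y → x ≡ y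
    Σ-T-≡ {v , sv} {.v , sv′} refl = cong (v ,_) (T-irrelevant sv sv′)

cast↔ : ∀ {m n} → .(m ≡ n) → Fin m ↔ Fin n
cast↔ eq = mk↔ₛ′ (cast eq) (cast (sym eq)) (cast-involutive eq (sym eq)) (cast-involutive (sym eq) eq)

≅-dgr-replicate : ∀ {s} (H : Graph s 0) (a : Fin s) m →
                  H ≅ dgr (replicate m a) ⇔ ((∀ i → lab H i ≡ a) × (Fin (n H) ↔ Fin m))
≅-dgr-replicate H a m = mk⇔ split join
  where
  lookup-replicate-any : ∀ j → lookup (replicate m a) j ≡ a
  lookup-replicate-any j =
    trans (cong (lookup (replicate m a)) (sym (cast-involutive _ (length-replicate m) j)))
          (lookup-replicate m a _)

  split : H ≅ dgr (replicate m a) → (∀ i → lab H i ≡ a) × (Fin (n H) ↔ Fin m)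
  split H≅ = (λ i → trans (sym (_≅_.lab-ok H≅ i)) (lookup-replicate-any _))
           , ↔-trans (_≅_.iso H≅) (cast↔ (length-replicate m))

  join : (∀ i → lab H i ≡ a) × (Fin (n H) ↔ Fin m) → H ≅ dgr (replicate m a)
  join (labels , φ) = record
    { iso     = ↔-trans φ (cast↔ (sym (length-replicate m)))
    ; lab-ok  = λ i → trans (lookup-replicate m a (Inverse.to φ i)) (sym (labels i))
    ; edge-ok = λ _ ()
    }

ExitsBy : ∀ {s g} (G : Graph s g) → Fin g → Subset (n G) → Set
ExitsBy G γ S = ∃₂ λ u v → (T (S u) × T (edge G u γ v)) × ¬ T (S v)

PredClosed : ∀ {s g} (G : Graph s g) → Subset (n G) → Set
PredClosed G S = ∀ u γ v → T (edge G u γ v) → T (S v) → T (S u)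

strEdge-step : ∀ {d} (w : List (Fin d)) k → T (strEdge w (inject₁ k) (lookup w k) (suc k))
strEdge-step (x ∷ _) zero    = fromWitness refl
strEdge-step (_ ∷ w) (suc k) = strEdge-step w k

strEdge⇒step : ∀ {d} (w : List (Fin d)) {i γ j} → T (strEdge w i γ j) →
               ∃ λ k → i ≡ inject₁ k × j ≡ suc k × lookup w k ≡ γ
strEdge⇒step (x ∷ w) {zero}  {j = suc zero} e = zero , refl , refl , toWitness e
strEdge⇒step (x ∷ w) {suc i} {j = suc j}    e with strEdge⇒step w e
... | k , refl , refl , wk≡γ = suc k , refl , refl , wk≡γ

module _ {d} (w : List (Fin d)) where

  strGraph-prefix : (a : Fin d) (S : Subset (suc (length w))) →
                    (ExitsBy (strGraph w) a S × PredClosed (strGraph w) S) ⇔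
                    ∃ λ k → lookup w k ≡ a × (∀ u → T (S u) ⇔ toℕ u ≤ toℕ k)
  strGraph-prefix a S = mk⇔ prefix exitsClosed
    where
    prefix : ExitsBy (strGraph w) a S × PredClosed (strGraph w) S →
             ∃ λ k → lookup w k ≡ a × (∀ u → T (S u) ⇔ toℕ u ≤ toℕ k)
    prefix ((u , v , (su , e) , ¬sv) , closed) with strEdge⇒step w e
    ... | k , refl , refl , wk≡a =
      k , wk≡a , downClosed-prefix (T ∘ S) (λ j → closed (inject₁ j) (lookup w j) (suc j) (strEdge-step w j)) su ¬sv

    exitsClosed : ∃ (λ k → lookup w k ≡ a × (∀ u → T (S u) ⇔ toℕ u ≤ toℕ k)) →
                  ExitsBy (strGraph w) a S × PredClosed (strGraph w) S
    exitsClosed (k , wk≡a , spec) = exits , closed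
      where
      exits : ExitsBy (strGraph w) a S
      exits = inject₁ k , suc k
            , (from (spec _) (≤-reflexive (toℕ-inject₁ k)) , subst (λ γ → T (strEdge w (inject₁ k) γ (suc k))) wk≡a (strEdge-step w k))
            , λ sk+1 → n≮n _ (to (spec (suc k)) sk+1)

      closed : PredClosed (strGraph w) S
      closed u γ v e sv with strEdge⇒step w e
      ... | j , refl , refl , _ = from (spec _) (≤-trans (≤-reflexive (toℕ-inject₁ j)) (<⇒≤ (to (spec (suc j)) sv)))

module PrefixTransducer (d : ℕ) (a : Fin d) where

  -- de Bruijn indices: under ∃src ∃tgt the outer variable src is suc zero.
  src tgt : Fin 2
  src = suc zero
  tgt = zero

  Y₁ : Fin 1
  Y₁ = zero

  -- The only node label is #, so ¬ lab_#(x) is a contradiction.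
  falseF : ∀ {k m} → Fin k → Form 1 d k m
  falseF x = notF (labF zero x)

  _⇒F_ : ∀ {k m} → Form 1 d k m → Form 1 d k m → Form 1 d k m
  φ ⇒F ψ = orF (notF φ) ψ

  someEdgeF : ∀ {k m} → List (Fin d) → Fin k → Fin k → Form 1 d k m
  someEdgeF []       x y = falseF x
  someEdgeF (γ ∷ γs) x y = orF (edgF γ x y) (someEdgeF γs x y)

  exitF : Form 1 d 0 1
  exitF = exN (exN (andF (andF (memF src Y₁) (edgF a src tgt)) (notF (memF tgt Y₁))))

  predClosedF : Form 1 d 0 1
  predClosedF = allN (allN (andF (someEdgeF (allFin d) src tgt) (memF tgt Y₁) ⇒F memF src Y₁))

  labelF : Fin d → Form 1 d 1 1
  labelF σ = if ⌊ σ ≟ a ⌋ then memF zero Y₁ else falseF zero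

  N : MSOT 1 d d 0
  N = record { nC = 1 ; p = 1 ; dom = andF exitF predClosedF ; nodeF = λ _ → labelF ; edgeF = λ _ _ () }

  module _ (G : Graph 1 d) where

    eval-falseF : ∀ {k m} (x : Fin k) ρ η → eval G (falseF {m = m} x) ρ η ≡ false
    eval-falseF x ρ η with lab G (ρ x)
    ... | zero = refl

    eval-someEdgeF : ∀ {k m} γs (x y : Fin k) ρ η →
                     eval G (someEdgeF {m = m} γs x y) ρ η ≡ any (λ γ → edge G (ρ x) γ (ρ y)) γs
    eval-someEdgeF []       x y ρ η = eval-falseF x ρ η
    eval-someEdgeF (γ ∷ γs) x y ρ η = cong (edge G (ρ x) γ (ρ y) ∨_) (eval-someEdgeF γs x y ρ η)

    T-exitF : ∀ η → T (eval G exitF (λ ()) η) ⇔ ExitsBy G a (η Y₁)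
    T-exitF η = mk⇔ exits formula
      where
      exits : T (eval G exitF (λ ()) η) → ExitsBy G a (η Y₁)
      exits t =
        let u , t₁ = to (T-any-allFin _) t
            v , t₂ = to (T-any-allFin _) t₁
            t₃ , ¬sv = to T-∧ t₂
        in u , v , to T-∧ t₃ , to T-not ¬sv

      formula : ExitsBy G a (η Y₁) → T (eval G exitF (λ ()) η)
      formula (u , v , su∧e , ¬sv) =
        from (T-any-allFin _) (u , from (T-any-allFin _) (v , from T-∧ (from T-∧ su∧e , from T-not ¬sv)))

    T-predClosedF : ∀ η → T (eval G predClosedF (λ ()) η) ⇔ PredClosed G (η Y₁)
    T-predClosedF η = mk⇔ closed formula
      where
      ρ : Fin (n G) → Fin (n G) → Fin 2 → Fin (n G)
      ρ u v = ext v (ext u (λ ()))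

      T-someEdge : ∀ u v → T (eval G (someEdgeF (allFin d) src tgt) (ρ u v) η) ⇔ ∃ λ γ → T (edge G u γ v)
      T-someEdge u v = subst (λ b → T b ⇔ _) (sym (eval-someEdgeF (allFin d) src tgt (ρ u v) η)) (T-any-allFin _)

      closed : T (eval G predClosedF (λ ()) η) → PredClosed G (η Y₁)
      closed t u γ v e sv =
        to T-not-∨ (to (T-all-allFin _) (to (T-all-allFin _) t u) v) (from T-∧ (from (T-someEdge u v) (γ , e) , sv))

      formula : PredClosed G (η Y₁) → T (eval G predClosedF (λ ()) η)
      formula c = from (T-all-allFin _) λ u → from (T-all-allFin _) λ v → from T-not-∨ λ t →
        let te , sv = to T-∧ t
            γ , e   = to (T-someEdge u v) te
        in c u γ v e sv

    T-dom : ∀ η → T (eval G (dom N) (λ ()) η) ⇔ (ExitsBy G a (η Y₁) × PredClosed G (η Y₁))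
    T-dom η = ⇔-trans T-∧ (T-exitF η ×-⇔ T-predClosedF η)

    eval-labelF : ∀ σ ρ η → eval G (labelF σ) ρ η ≡ ⌊ σ ≟ a ⌋ ∧ η Y₁ (ρ zero)
    eval-labelF σ ρ η with σ ≟ a
    ... | yes _ = refl
    ... | no  _ = eval-falseF zero ρ η

    labOf-a : ∀ η c u → T (η Y₁ u) → T (labOf N G η c u a)
    labOf-a η c u su = from T-∧ (labelled , from (T-all-allFin _) unique)
      where
      labelled : T (eval G (labelF a) (one N G η u) η)
      labelled = subst T (sym (eval-labelF a _ η)) (from T-∧ (fromWitness refl , su))

      unique : ∀ σ → T (⌊ σ ≟ a ⌋ ∨ not (eval G (labelF σ) (one N G η u) η))
      unique σ = subst (λ b → T (⌊ σ ≟ a ⌋ ∨ not b)) (sym (eval-labelF σ _ η)) (T-∨-not-∧ ⌊ σ ≟ a ⌋ (η Y₁ u))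

    T-labOf : ∀ η c u σ → T (labOf N G η c u σ) ⇔ (σ ≡ a × T (η Y₁ u))
    T-labOf η c u σ = mk⇔ labelled (λ (σ≡a , su) → subst (T ∘ labOf N G η c u) (sym σ≡a) (labOf-a η c u su))
      where
      labelled : T (labOf N G η c u σ) → σ ≡ a × T (η Y₁ u)
      labelled t =
        let σ≟a , su = to T-∧ (subst T (eval-labelF σ _ η) (proj₁ (to T-∧ t)))
        in toWitness σ≟a , su

    outLab≡a : ∀ η (o : OutNode N G η) → outLab N G η o ≡ a
    outLab≡a η ((c , u , σ) , t) = proj₁ (to (T-labOf η c u σ) t)

    OutNode↔Σ : ∀ η → OutNode N G η ↔ Σ (Fin (n G)) (T ∘ η Y₁)
    OutNode↔Σ η = mk↔ₛ′ node copy (λ (u , su) → cong (u ,_) (T-irrelevant _ _)) copy∘node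
      where
      node : OutNode N G η → Σ (Fin (n G)) (T ∘ η Y₁)
      node ((c , u , σ) , t) = u , proj₂ (to (T-labOf η c u σ) t)

      copy : Σ (Fin (n G)) (T ∘ η Y₁) → OutNode N G η
      copy (u , su) = (zero , u , a) , labOf-a η zero u su

      copy∘node : ∀ o → copy (node o) ≡ o
      copy∘node ((zero , u , σ) , t) with to (T-labOf η zero u σ) t
      ... | refl , _ = cong ((zero , u , a) ,_) (T-irrelevant _ _)

    IsOutput⇔ : ∀ η H → IsOutput N G η H ⇔ ((∀ i → lab H i ≡ a) × (Fin (n H) ↔ OutNode N G η))
    IsOutput⇔ η H = mk⇔ (λ o → (λ i → trans (IsOutput.lab-ok o i) (outLab≡a η (Inverse.to (IsOutput.iso o) i))) , IsOutput.iso o) output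
      where
      output : (∀ i → lab H i ≡ a) × (Fin (n H) ↔ OutNode N G η) → IsOutput N G η H
      output (labels , ι) = record
        { iso     = ι
        ; lab-ok  = λ i → trans (labels i) (sym (outLab≡a η (Inverse.to ι i)))
        ; edge-ok = λ _ ()
        }

  module _ (w : List (Fin d)) where

    OutNode↔Fin : ∀ {η k} → (∀ u → T (η Y₁ u) ⇔ toℕ u ≤ toℕ k) → OutNode N (strGraph w) η ↔ Fin (suc (toℕ k))
    OutNode↔Fin {η} {k} spec = ↔-trans (OutNode↔Σ (strGraph w) η) (Σ-≤↔Fin (η Y₁) (m<n⇒m<1+n (toℕ<n k)) spec)

    module _ (H : Graph d 0) where

      N-sound : H ∈⟦ N ⟧ strGraph w →
                ∃ λ (k : Fin (length w)) → lookup w k ≡ a × H ≅ dgr (replicate (suc (toℕ k)) a)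
      N-sound (η , dom , out) =
        let k , wk≡a , spec = to (strGraph-prefix w a (η Y₁)) (to (T-dom (strGraph w) η) dom)
            labels , ι      = to (IsOutput⇔ (strGraph w) η H) out
        in k , wk≡a , from (≅-dgr-replicate H a _) (labels , ↔-trans ι (OutNode↔Fin spec))

      N-complete : (∃ λ (k : Fin (length w)) → lookup w k ≡ a × H ≅ dgr (replicate (suc (toℕ k)) a)) →
                   H ∈⟦ N ⟧ strGraph w
      N-complete (k , wk≡a , H≅) =
        let labels , φ = to (≅-dgr-replicate H a _) H≅
        in η , from (T-dom (strGraph w) η) (from (strGraph-prefix w a (η Y₁)) (k , wk≡a , spec))
             , from (IsOutput⇔ (strGraph w) η H) (labels , ↔-trans φ (↔-sym (OutNode↔Fin spec)))
        where
        η : Fin 1 → Subset (suc (length w))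
        η _ u = toℕ u ≤ᵇ toℕ k

        spec : ∀ u → T (η Y₁ u) ⇔ toℕ u ≤ toℕ k
        spec u = mk⇔ (≤ᵇ⇒≤ _ _) ≤⇒≤ᵇ

lemma4 : (d : ℕ) (a : Fin d) →
    Σ (MSOT 1 d d 0) λ N →
      (w : List (Fin d)) (H : Graph d 0) →
        (H ∈⟦ N ⟧ strGraph w) ⇔
        (∃ λ (i : Fin (length w)) → (lookup w i ≡ a) × (H ≅ dgr (replicate (suc (toℕ i)) a)))
lemma4 d a = N , λ w H → mk⇔ (N-sound w H) (N-complete w H)
  where open PrefixTransducer d a
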